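{- Let $A$ be a square-zero quadratic monomial quotient with $A_{q+1}=0$. Let $U$ and $V$ be distinct parallel classes such that \(x_ux_v=0\) for all $u\in U$ and $v\in V$. Fix a degree $r$. Then one can replace either $U$ by clones of $V$ or $V$ by clones of $U$ so as to obtain another square-zero quadratic monomial quotient $A'$ on the same $n$ variables with \((A')_{q+1}=0\) and \(\dim_{\mathbf{k}} (A')_r\ge \dim_{\mathbf{k}} A_r\). Moreover, this replacement merges the two classes into one parallel class and leaves all other products unchanged except those involving the cloned class.
   Context: Let $\mathbf{k}$ be a field of characteristic zero and $S=\mathbf{k}[x_1,\ldots,x_n]$. A square-zero quadratic monomial quotient is $A=S/I$ with $I=(x_1^2,\ldots,x_n^2,\ x_ax_b$ for some pairs $\{a,b\}\subset[n])$; $A_d$ denotes its degree-$d$ graded piece. Two variables $x_i,x_j$ are parallel in $A$ if $x_ix_j=0$ and, for every $h\notin\{i,j\}$, $x_ix_h=0$ iff $x_jx_h=0$; this is an equivalence relation whose classes are called parallel classes. Replacing $V$ by clones of $U$ means: all products inside $U\cup V$ are set to zero, for $v\in V$ and $z\notin U\cup V$ one imposes $x_vz=0$ iff $x_uz=0$ for $u\in U$, and all products not involving $V$ are kept as in $A$. -}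

module Defs where

open import Data.Nat using (ℕ; zero; suc)
open import Data.Bool using (Bool; true; false; _∧_; _∨_; not)
open import Data.Fin using (Fin)
open import Data.Fin.Properties using (_≟_)
open import Data.Fin.Subset using (Subset; _∈_; _∉_; _∪_; ∣_∣)
open import Data.List using (List; []; _∷_; map; _++_; length; filterᵇ; allFin)
open import Data.Bool.ListAction using (and)
open import Data.Vec using (Vec; []; _∷_; lookup)
open import Data.Nat using (_≡ᵇ_)
open import Relation.Nullary using (does)
open import Relation.Binary.PropositionalEquality using (_≡_; _≢_)
open import Data.Product using (_×_; ∃)

-- A square-zero quadratic monomial quotient A = S / I on n variables,
-- with I = (x_1^2, ..., x_n^2, x_a x_b for selected pairs {a,b}).
-- `kill a b ≡ true` (for a ≢ b) means the generator x_a x_b belongs to I.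
-- The diagonal values of `kill` are irrelevant (x_a^2 ∈ I always).
record SZQ (n : ℕ) : Set where
  field
    kill     : Fin n → Fin n → Bool
    kill-sym : ∀ a b → kill a b ≡ kill b a
open SZQ public

prodZero : ∀ {n} → SZQ n → Fin n → Fin n → Bool
prodZero A a b = does (a ≟ b) ∨ kill A a b

ProdZero : ∀ {n} → SZQ n → Fin n → Fin n → Set
ProdZero A a b = prodZero A a b ≡ true

allSubsets : (n : ℕ) → List (Subset n)
allSubsets zero    = [] ∷ []
allSubsets (suc n) = map (true ∷_) (allSubsets n) ++ map (false ∷_) (allSubsets n)

nonzeroMono : ∀ {n} → SZQ n → Subset n → Bool
nonzeroMono {n} A S =
  and (map (λ i → and (map (λ j →
        not (lookup S i ∧ lookup S j ∧ not (does (i ≟ j)) ∧ kill A i j))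
      (allFin n))) (allFin n))

-- dim_k A_d : A is a monomial quotient, so A_d has as k-basis the monomials of
-- degree d not in I; since x_i^2 ∈ I these are the squarefree monomials of
-- degree d none of whose pairs x_a x_b is a generator of I.
dimA : ∀ {n} → SZQ n → ℕ → ℕ
dimA {n} A d = length (filterᵇ (λ S → (∣ S ∣ ≡ᵇ d) ∧ nonzeroMono A S) (allSubsets n))

Parallel : ∀ {n} → SZQ n → Fin n → Fin n → Set
Parallel A i j =
  ProdZero A i j × (∀ h → h ≢ i → h ≢ j → prodZero A i h ≡ prodZero A j h)

IsParallelClass : ∀ {n} → SZQ n → Subset n → Set
IsParallelClass A U =
  (∃ λ u → u ∈ U) × (∀ u → u ∈ U → ∀ j → (j ∈ U → Parallel A u j) × (Parallel A u j → j ∈ U))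

ReplaceByClones : ∀ {n} → SZQ n → Subset n → Subset n → SZQ n → Set
ReplaceByClones A U V A' =
  (∀ i j → i ∈ (U ∪ V) → j ∈ (U ∪ V) → ProdZero A' i j)
  × (∀ v u z → v ∈ V → u ∈ U → z ∉ U → z ∉ V → prodZero A' v z ≡ prodZero A u z)
  × (∀ i j → i ∉ V → j ∉ V → prodZero A' i j ≡ prodZero A i j)

-- W = U ∪ V is square-zero, so a nonzero monomial contains at most one variable of W. Hence
--   dim A_d = c_d + Σ_{w ∈ W} a_d(w),
-- where c_d (basisAvoiding) counts the degree-d basis monomials avoiding W and a_d(w)
-- (basisThrough) counts those of the form x_T x_w with T disjoint from W. Whether x_T x_w is
-- nonzero only involves products of variables outside W and the products x_w x_h with h ∉ W,
-- so a_d is constant on each parallel class, and after cloning V onto U it takes the value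
-- a_d(u₀) on all of W while c_d is unchanged. Cloning onto the class with the larger a_r
-- therefore does not decrease dim A_r, and since a_{q+1}(u₀) ≤ dim A_{q+1} = 0 the clone still
-- vanishes in degree q+1.
module Submission where

open import Defs
open import Data.Bool.Base using (Bool; true; false; _∧_; _∨_; not; if_then_else_)
open import Data.Bool.ListAction using (and)
open import Data.Bool.Properties using (∧-comm; ∧-zeroʳ; ∧-conicalˡ; ∧-conicalʳ; ∨-zeroʳ; ¬-not; ⇔→≡)
open import Data.Fin.Base using (Fin; zero; suc)
open import Data.Fin.Properties using (_≟_)
open import Data.Fin.Subset using (Subset; _∈_; _∉_; _∩_; _∪_; ⁅_⁆; ∣_∣; Empty)
open import Data.Fin.Subset.Properties
  using (nonempty?; _∈?_; Empty-unique; ∣⊥∣≡0; ∣⁅x⁆∣≡1; x∈⁅x⁆; x∈⁅y⁆⇒x≡y; ⊆-antisym;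
         x∈p∩q⁺; x∈p∩q⁻; x∈p∪q⁺; x∈p∪q⁻; ∪-comm)
open import Data.List.Base using (List; []; _∷_; _++_; map; length; filterᵇ; allFin; tabulate)
open import Data.List.Properties using (map-++; map-∘; map-tabulate)
open import Data.Nat.Base using (ℕ; zero; suc; _+_; _*_; _≤_; _≥_; _≡ᵇ_; z≤n)
open import Data.Nat.Properties
  using (+-comm; +-identityʳ; *-identityˡ; *-identityʳ; *-zeroʳ; +-mono-≤; +-monoʳ-≤; m≤m+n; m≤n+m;
         ≤-trans; ≤-reflexive; ≤-total; m+n≡0⇒m≡0; m+n≡0⇒n≡0; n≤0⇒n≡0; +-commutativeSemigroup;
         module ≤-Reasoning)
open import Algebra.Properties.CommutativeSemigroup +-commutativeSemigroup using (interchange)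
import Data.Nat.ListAction as List
open import Data.Nat.ListAction.Properties using (sum-++)
open import Data.Product using (_×_; _,_; proj₁; proj₂; ∃; map₁; map₂)
open import Data.Sum using (_⊎_; inj₁; inj₂; [_,_]′)
open import Data.Vec.Base using ([]; _∷_; lookup; _[_]≔_; here; there)
open import Data.Vec.Properties using ([]=⇒lookup; lookup⇒[]=; updateAt-minimal; lookup∘updateAt′; []≔-updates)
open import Function.Base using (_∘_; flip)
open import Function.Bundles using (_⇔_; mk⇔; module Equivalence)
open import Relation.Binary.PropositionalEquality
open import Relation.Nullary using (yes; no; does; contradiction)
open import Relation.Nullary.Decidable using (dec-true; dec-false)

open Equivalence using (to; from)

private
  variable
    n : ℕ

𝟙 : Bool → ℕ
𝟙 true  = 1
𝟙 false = 0

∑ₛ : (Subset n → ℕ) → ℕ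
∑ₛ {zero}  f = f []
∑ₛ {suc n} f = ∑ₛ (λ S → f (true ∷ S)) + ∑ₛ (λ S → f (false ∷ S))

∑ₛ-cong : {f g : Subset n → ℕ} → (∀ S → f S ≡ g S) → ∑ₛ f ≡ ∑ₛ g
∑ₛ-cong {zero}  f≗g = f≗g []
∑ₛ-cong {suc n} f≗g = cong₂ _+_ (∑ₛ-cong (f≗g ∘ (true ∷_))) (∑ₛ-cong (f≗g ∘ (false ∷_)))

∑ₛ-zero : ∀ n → ∑ₛ {n} (λ _ → 0) ≡ 0
∑ₛ-zero zero    = refl
∑ₛ-zero (suc n) = cong₂ _+_ (∑ₛ-zero n) (∑ₛ-zero n)

∑ₛ-distrib-+ : (f g : Subset n → ℕ) → ∑ₛ (λ S → f S + g S) ≡ ∑ₛ f + ∑ₛ g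
∑ₛ-distrib-+ {zero}  f g = refl
∑ₛ-distrib-+ {suc n} f g = trans
  (cong₂ _+_ (∑ₛ-distrib-+ (f ∘ (true ∷_)) (g ∘ (true ∷_))) (∑ₛ-distrib-+ (f ∘ (false ∷_)) (g ∘ (false ∷_))))
  (interchange (∑ₛ (f ∘ (true ∷_))) (∑ₛ (g ∘ (true ∷_))) (∑ₛ (f ∘ (false ∷_))) (∑ₛ (g ∘ (false ∷_))))

-- Each S ∋ w arises as T [ w ]≔ true from exactly one T ∌ w.
∑ₛ-[]≔true : (w : Fin n) (f : Subset n → ℕ) →
  ∑ₛ (λ T → 𝟙 (not (lookup T w)) * f (T [ w ]≔ true)) ≡ ∑ₛ (λ S → 𝟙 (lookup S w) * f S)
∑ₛ-[]≔true {suc n} zero    f = +-comm (∑ₛ {n} (λ _ → 0)) _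
∑ₛ-[]≔true {suc n} (suc w) f = cong₂ _+_ (∑ₛ-[]≔true w (f ∘ (true ∷_))) (∑ₛ-[]≔true w (f ∘ (false ∷_)))

∑ₛ-allSubsets : (f : Subset n → ℕ) → List.sum (map f (allSubsets n)) ≡ ∑ₛ f
∑ₛ-allSubsets {zero}  f = +-identityʳ (f [])
∑ₛ-allSubsets {suc n} f = begin
  List.sum (map f (map (true ∷_) Ss ++ map (false ∷_) Ss))
    ≡⟨ cong List.sum (map-++ f (map (true ∷_) Ss) _) ⟩
  List.sum (map f (map (true ∷_) Ss) ++ map f (map (false ∷_) Ss))
    ≡⟨ sum-++ (map f (map (true ∷_) Ss)) _ ⟩
  List.sum (map f (map (true ∷_) Ss)) + List.sum (map f (map (false ∷_) Ss))
    ≡⟨ cong₂ _+_ (cong List.sum (sym (map-∘ Ss))) (cong List.sum (sym (map-∘ Ss))) ⟩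
  List.sum (map (f ∘ (true ∷_)) Ss) + List.sum (map (f ∘ (false ∷_)) Ss)
    ≡⟨ cong₂ _+_ (∑ₛ-allSubsets (f ∘ (true ∷_))) (∑ₛ-allSubsets (f ∘ (false ∷_))) ⟩
  ∑ₛ f ∎
  where
  open ≡-Reasoning
  Ss : List (Subset n)
  Ss = allSubsets n

length-filterᵇ≡sum : ∀ {A : Set} (p : A → Bool) xs → length (filterᵇ p xs) ≡ List.sum (map (𝟙 ∘ p) xs)
length-filterᵇ≡sum p []       = refl
length-filterᵇ≡sum p (x ∷ xs) with p x
... | true  = cong suc (length-filterᵇ≡sum p xs)
... | false = length-filterᵇ≡sum p xs

∑∈ : Subset n → (Fin n → ℕ) → ℕ
∑∈ []          f = 0
∑∈ (true ∷ W)  f = f zero + ∑∈ W (f ∘ suc)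
∑∈ (false ∷ W) f = ∑∈ W (f ∘ suc)

∑∈-cong : ∀ (W : Subset n) {f g : Fin n → ℕ} → (∀ {w} → w ∈ W → f w ≡ g w) → ∑∈ W f ≡ ∑∈ W g
∑∈-cong []          f≗g = refl
∑∈-cong (true ∷ W)  f≗g = cong₂ _+_ (f≗g here) (∑∈-cong W (f≗g ∘ there))
∑∈-cong (false ∷ W) f≗g = ∑∈-cong W (f≗g ∘ there)

∑∈-mono-≤ : ∀ (W : Subset n) {f g : Fin n → ℕ} → (∀ {w} → w ∈ W → f w ≤ g w) → ∑∈ W f ≤ ∑∈ W g
∑∈-mono-≤ []          f≤g = z≤n
∑∈-mono-≤ (true ∷ W)  f≤g = +-mono-≤ (f≤g here) (∑∈-mono-≤ W (f≤g ∘ there))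
∑∈-mono-≤ (false ∷ W) f≤g = ∑∈-mono-≤ W (f≤g ∘ there)

f≤∑∈f : ∀ {W : Subset n} (f : Fin n → ℕ) {w} → w ∈ W → f w ≤ ∑∈ W f
f≤∑∈f {W = true ∷ W}  f here        = m≤m+n (f zero) _
f≤∑∈f {W = true ∷ W}  f (there w∈W) = ≤-trans (f≤∑∈f (f ∘ suc) w∈W) (m≤n+m _ (f zero))
f≤∑∈f {W = false ∷ W} f (there w∈W) = f≤∑∈f (f ∘ suc) w∈W

∑∈-zero : ∀ (W : Subset n) → ∑∈ W (λ _ → 0) ≡ 0
∑∈-zero []          = refl
∑∈-zero (true ∷ W)  = ∑∈-zero W
∑∈-zero (false ∷ W) = ∑∈-zero W

∑∈-𝟙 : ∀ (W S : Subset n) x → ∑∈ W (λ w → 𝟙 (lookup S w) * x) ≡ ∣ W ∩ S ∣ * x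
∑∈-𝟙 []          []          x = refl
∑∈-𝟙 (true ∷ W)  (true ∷ S)  x = cong₂ _+_ (*-identityˡ x) (∑∈-𝟙 W S x)
∑∈-𝟙 (true ∷ W)  (false ∷ S) x = ∑∈-𝟙 W S x
∑∈-𝟙 (false ∷ W) (_ ∷ S)     x = ∑∈-𝟙 W S x

∑ₛ-∑∈-comm : ∀ {m} (W : Subset n) (f : Fin n → Subset m → ℕ) →
  ∑ₛ (λ S → ∑∈ W (λ w → f w S)) ≡ ∑∈ W (λ w → ∑ₛ (f w))
∑ₛ-∑∈-comm {m = m} []  f = ∑ₛ-zero m
∑ₛ-∑∈-comm (true ∷ W)  f = trans (∑ₛ-distrib-+ (f zero) _) (cong (∑ₛ (f zero) +_) (∑ₛ-∑∈-comm W (f ∘ suc)))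
∑ₛ-∑∈-comm (false ∷ W) f = ∑ₛ-∑∈-comm W (f ∘ suc)

x∈p∧y∉p⇒x≢y : ∀ {p : Subset n} {x y} → x ∈ p → y ∉ p → x ≢ y
x∈p∧y∉p⇒x≢y x∈p y∉p refl = y∉p x∈p

x∉p⇒lookup≡false : ∀ {p : Subset n} {x} → x ∉ p → lookup p x ≡ false
x∉p⇒lookup≡false {p = p} {x} x∉p = ¬-not (x∉p ∘ lookup⇒[]= x p)

Empty[p∩q]∧x∈p⇒x∉q : ∀ {p q : Subset n} {x} → Empty (p ∩ q) → x ∈ p → x ∉ q
Empty[p∩q]∧x∈p⇒x∉q p∩q=∅ x∈p x∈q = p∩q=∅ (_ , x∈p∩q⁺ (x∈p , x∈q))

Empty[p∩q]∧x∈q⇒x∉p : ∀ {p q : Subset n} {x} → Empty (p ∩ q) → x ∈ q → x ∉ p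
Empty[p∩q]∧x∈q⇒x∉p p∩q=∅ x∈q x∈p = p∩q=∅ (_ , x∈p∩q⁺ (x∈p , x∈q))

x∉p∪q⇒x∉p : ∀ {p q : Subset n} {x} → x ∉ p ∪ q → x ∉ p
x∉p∪q⇒x∉p x∉p∪q x∈p = x∉p∪q (x∈p∪q⁺ (inj₁ x∈p))

x∉p∪q⇒x∉q : ∀ {p q : Subset n} {x} → x ∉ p ∪ q → x ∉ q
x∉p∪q⇒x∉q x∉p∪q x∈q = x∉p∪q (x∈p∪q⁺ (inj₂ x∈q))

x∈p[x]≔true : ∀ (p : Subset n) x → x ∈ p [ x ]≔ true
x∈p[x]≔true = []≔-updates

x∈p⇒x∈p[y]≔b : ∀ {p : Subset n} {x y} b → x ≢ y → x ∈ p → x ∈ p [ y ]≔ b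
x∈p⇒x∈p[y]≔b {p = p} b x≢y x∈p = updateAt-minimal _ _ p x≢y x∈p

x∈p[y]≔b⇒x∈p : ∀ {p : Subset n} {x y} b → x ≢ y → x ∈ p [ y ]≔ b → x ∈ p
x∈p[y]≔b⇒x∈p {p = p} {x} {y} b x≢y x∈ =
  lookup⇒[]= x p (trans (sym (lookup∘updateAt′ x y x≢y p)) ([]=⇒lookup x∈))

x∉p⇒∣p[x]≔true∣≡suc∣p∣ : ∀ (p : Subset n) x → x ∉ p → ∣ p [ x ]≔ true ∣ ≡ suc ∣ p ∣
x∉p⇒∣p[x]≔true∣≡suc∣p∣ (true ∷ p)  zero    x∉p = contradiction here x∉p
x∉p⇒∣p[x]≔true∣≡suc∣p∣ (false ∷ p) zero    x∉p = refl
x∉p⇒∣p[x]≔true∣≡suc∣p∣ (true ∷ p)  (suc x) x∉p = cong suc (x∉p⇒∣p[x]≔true∣≡suc∣p∣ p x (x∉p ∘ there))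
x∉p⇒∣p[x]≔true∣≡suc∣p∣ (false ∷ p) (suc x) x∉p = x∉p⇒∣p[x]≔true∣≡suc∣p∣ p x (x∉p ∘ there)

and-tabulate⇔ : ∀ (f : Fin n → Bool) → and (tabulate f) ≡ true ⇔ (∀ i → f i ≡ true)
and-tabulate⇔ {zero}  f = mk⇔ (λ _ ()) (λ _ → refl)
and-tabulate⇔ {suc n} f = mk⇔ allTrue (λ h → cong₂ _∧_ (h zero) (from rest (h ∘ suc)))
  where
  rest : and (tabulate (f ∘ suc)) ≡ true ⇔ (∀ i → f (suc i) ≡ true)
  rest = and-tabulate⇔ (f ∘ suc)
  allTrue : f zero ∧ and (tabulate (f ∘ suc)) ≡ true → ∀ i → f i ≡ true
  allTrue e zero    = ∧-conicalˡ _ _ e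
  allTrue e (suc i) = to rest (∧-conicalʳ _ _ e) i

and-allFin⇔ : ∀ (f : Fin n → Bool) → and (map f (allFin n)) ≡ true ⇔ (∀ i → f i ≡ true)
and-allFin⇔ {n} f rewrite map-tabulate {n = n} (λ i → i) f = and-tabulate⇔ f

pairCondition⇔ : ∀ a b c k → not (a ∧ b ∧ not c ∧ k) ≡ true ⇔ (a ≡ true → b ≡ true → c ≡ false → k ≡ false)
pairCondition⇔ false b     c     k     = mk⇔ (λ _ ()) (λ _ → refl)
pairCondition⇔ true  false c     k     = mk⇔ (λ _ _ ()) (λ _ → refl)
pairCondition⇔ true  true  true  k     = mk⇔ (λ _ _ _ ()) (λ _ → refl)
pairCondition⇔ true  true  false false = mk⇔ (λ _ _ _ _ → refl) (λ _ → refl)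
pairCondition⇔ true  true  false true  = mk⇔ (λ ()) (λ h → sym (h refl refl refl))

NonzeroMonomial : SZQ n → Subset n → Set
NonzeroMonomial B S = ∀ {i j} → i ∈ S → j ∈ S → i ≢ j → kill B i j ≡ false

AllProductsZero : SZQ n → Subset n → Set
AllProductsZero B W = ∀ {i j} → i ∈ W → j ∈ W → i ≢ j → kill B i j ≡ true

nonzeroMono⇔ : ∀ (B : SZQ n) S → nonzeroMono B S ≡ true ⇔ NonzeroMonomial B S
nonzeroMono⇔ {n} B S = mk⇔
  (λ nz {i} {j} → to (ok⇔ i j) (to (and-allFin⇔ (ok i)) (to (and-allFin⇔ _) nz i) j))
  (λ nz → from (and-allFin⇔ _) λ i → from (and-allFin⇔ (ok i)) λ j → from (ok⇔ i j) nz)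
  where
  ok : Fin n → Fin n → Bool
  ok i j = not (lookup S i ∧ lookup S j ∧ not (does (i ≟ j)) ∧ kill B i j)
  ok⇔ : ∀ i j → ok i j ≡ true ⇔ (i ∈ S → j ∈ S → i ≢ j → kill B i j ≡ false)
  ok⇔ i j = mk⇔
    (λ okᵢⱼ i∈S j∈S i≢j →
      to (pairCondition⇔ _ _ _ _) okᵢⱼ ([]=⇒lookup i∈S) ([]=⇒lookup j∈S) (dec-false (i ≟ j) i≢j))
    (λ h → from (pairCondition⇔ _ _ _ _) λ Sᵢ Sⱼ i≟j → h (lookup⇒[]= i S Sᵢ) (lookup⇒[]= j S Sⱼ)
      (λ i≡j → contradiction (trans (sym i≟j) (dec-true (i ≟ j) i≡j)) λ ()))

nonzeroMono-≡ : ∀ {B B′ : SZQ n} {S S′} →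
  (NonzeroMonomial B S → NonzeroMonomial B′ S′) → (NonzeroMonomial B′ S′ → NonzeroMonomial B S) →
  nonzeroMono B S ≡ nonzeroMono B′ S′
nonzeroMono-≡ {B = B} {B′} {S} {S′} ⇒ ⇐ = ⇔→≡ {z = true} (mk⇔
  (from (nonzeroMono⇔ B′ S′) ∘ ⇒ ∘ to (nonzeroMono⇔ B S))
  (from (nonzeroMono⇔ B S) ∘ ⇐ ∘ to (nonzeroMono⇔ B′ S′)))

isBasisMonomial : SZQ n → ℕ → Subset n → Bool
isBasisMonomial B d S = (∣ S ∣ ≡ᵇ d) ∧ nonzeroMono B S

dimA≡∑ₛ : ∀ (B : SZQ n) d → dimA B d ≡ ∑ₛ (𝟙 ∘ isBasisMonomial B d)
dimA≡∑ₛ B d =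
  trans (length-filterᵇ≡sum (isBasisMonomial B d) (allSubsets _)) (∑ₛ-allSubsets (𝟙 ∘ isBasisMonomial B d))

isBasisMonomial-killed : ∀ (B : SZQ n) {S i j} d → i ∈ S → j ∈ S → i ≢ j → kill B i j ≡ true →
  isBasisMonomial B d S ≡ false
isBasisMonomial-killed B {S} d i∈S j∈S i≢j killed =
  trans (cong ((∣ S ∣ ≡ᵇ d) ∧_) (¬-not nonzero)) (∧-zeroʳ _)
  where
  nonzero : nonzeroMono B S ≢ true
  nonzero nz = contradiction (trans (sym killed) (to (nonzeroMono⇔ B S) nz i∈S j∈S i≢j)) λ ()

W∩S≡⁅x⁆ : ∀ (B : SZQ n) {W S x} → AllProductsZero B W → NonzeroMonomial B S → x ∈ W ∩ S → W ∩ S ≡ ⁅ x ⁆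
W∩S≡⁅x⁆ B {W} {S} {x} zeroW nz x∈W∩S = ⊆-antisym
  (λ y∈W∩S → subst (_∈ ⁅ x ⁆) (sym (unique y∈W∩S)) (x∈⁅x⁆ x))
  (λ y∈⁅x⁆ → subst (_∈ W ∩ S) (sym (x∈⁅y⁆⇒x≡y x y∈⁅x⁆)) x∈W∩S)
  where
  unique : ∀ {y} → y ∈ W ∩ S → y ≡ x
  unique {y} y∈W∩S with y ≟ x | x∈p∩q⁻ W S y∈W∩S | x∈p∩q⁻ W S x∈W∩S
  ... | yes y≡x | _         | _         = y≡x
  ... | no  y≢x | y∈W , y∈S | x∈W , x∈S =
    contradiction (trans (sym (zeroW y∈W x∈W y≢x)) (nz y∈S x∈S y≢x)) λ ()

avoids : Subset n → Subset n → Bool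
avoids W T = not (does (nonempty? (W ∩ T)))

basisAvoiding : SZQ n → Subset n → ℕ → ℕ
basisAvoiding B W d = ∑ₛ (λ T → 𝟙 (avoids W T) * 𝟙 (isBasisMonomial B d T))

basisThrough : SZQ n → Subset n → ℕ → Fin n → ℕ
basisThrough B W d w = ∑ₛ (λ T → 𝟙 (avoids W T) * 𝟙 (isBasisMonomial B d (T [ w ]≔ true)))

avoids+∣W∩S∣≡1 : ∀ (B : SZQ n) {W S} → AllProductsZero B W → NonzeroMonomial B S → 𝟙 (avoids W S) + ∣ W ∩ S ∣ ≡ 1
avoids+∣W∩S∣≡1 {n} B {W} {S} zeroW nz with nonempty? (W ∩ S)
... | no  W∩S=∅       rewrite Empty-unique W∩S=∅ = cong suc (∣⊥∣≡0 n)
... | yes (x , x∈W∩S) rewrite W∩S≡⁅x⁆ B zeroW nz x∈W∩S = ∣⁅x⁆∣≡1 x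

isBasisMonomial-split : ∀ (B : SZQ n) {W} → AllProductsZero B W → ∀ d S →
  𝟙 (isBasisMonomial B d S) ≡
    𝟙 (avoids W S) * 𝟙 (isBasisMonomial B d S) + ∑∈ W (λ w → 𝟙 (lookup S w) * 𝟙 (isBasisMonomial B d S))
isBasisMonomial-split B {W} zeroW d S rewrite ∑∈-𝟙 W S (𝟙 (isBasisMonomial B d S)) with isBasisMonomial B d S in basis
... | false = sym (cong₂ _+_ (*-zeroʳ (𝟙 (avoids W S))) (*-zeroʳ ∣ W ∩ S ∣))
... | true  rewrite *-identityʳ (𝟙 (avoids W S)) | *-identityʳ ∣ W ∩ S ∣ =
  sym (avoids+∣W∩S∣≡1 B zeroW (to (nonzeroMono⇔ B S) (∧-conicalʳ _ _ basis)))

∑ₛ-containing≡basisThrough : ∀ (B : SZQ n) {W w} → AllProductsZero B W → w ∈ W → ∀ d →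
  ∑ₛ (λ S → 𝟙 (lookup S w) * 𝟙 (isBasisMonomial B d S)) ≡ basisThrough B W d w
∑ₛ-containing≡basisThrough B {W} {w} zeroW w∈W d =
  trans (sym (∑ₛ-[]≔true w (𝟙 ∘ isBasisMonomial B d))) (∑ₛ-cong extension)
  where
  extension : ∀ T → 𝟙 (not (lookup T w)) * 𝟙 (isBasisMonomial B d (T [ w ]≔ true))
                  ≡ 𝟙 (avoids W T) * 𝟙 (isBasisMonomial B d (T [ w ]≔ true))
  extension T with nonempty? (W ∩ T)
  ... | no  W∩T=∅ rewrite x∉p⇒lookup≡false (Empty[p∩q]∧x∈p⇒x∉q W∩T=∅ w∈W) = refl
  ... | yes (x , x∈W∩T) with lookup T w in Tw
  ...   | true  = refl
  ...   | false = cong (λ b → 1 * 𝟙 b)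
    (isBasisMonomial-killed B d (x∈p⇒x∈p[y]≔b true x≢w x∈T) (x∈p[x]≔true T w) x≢w (zeroW x∈W w∈W x≢w))
    where
    x∈W : x ∈ W
    x∈W = proj₁ (x∈p∩q⁻ W T x∈W∩T)
    x∈T : x ∈ T
    x∈T = proj₂ (x∈p∩q⁻ W T x∈W∩T)
    x≢w : x ≢ w
    x≢w refl = contradiction (trans (sym ([]=⇒lookup x∈T)) Tw) λ ()

dimA-decomposition : ∀ (B : SZQ n) W → AllProductsZero B W → ∀ d →
  dimA B d ≡ basisAvoiding B W d + ∑∈ W (basisThrough B W d)
dimA-decomposition B W zeroW d = begin
  dimA B d
    ≡⟨ dimA≡∑ₛ B d ⟩
  ∑ₛ (𝟙 ∘ basis)
    ≡⟨ ∑ₛ-cong (isBasisMonomial-split B zeroW d) ⟩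
  ∑ₛ (λ S → 𝟙 (avoids W S) * 𝟙 (basis S) + ∑∈ W (λ w → 𝟙 (lookup S w) * 𝟙 (basis S)))
    ≡⟨ ∑ₛ-distrib-+ (λ S → 𝟙 (avoids W S) * 𝟙 (basis S)) _ ⟩
  basisAvoiding B W d + ∑ₛ (λ S → ∑∈ W (λ w → 𝟙 (lookup S w) * 𝟙 (basis S)))
    ≡⟨ cong (basisAvoiding B W d +_) (∑ₛ-∑∈-comm W (λ w S → 𝟙 (lookup S w) * 𝟙 (basis S))) ⟩
  basisAvoiding B W d + ∑∈ W (λ w → ∑ₛ (λ S → 𝟙 (lookup S w) * 𝟙 (basis S)))
    ≡⟨ cong (basisAvoiding B W d +_) (∑∈-cong W λ w∈W → ∑ₛ-containing≡basisThrough B zeroW w∈W d) ⟩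
  basisAvoiding B W d + ∑∈ W (basisThrough B W d) ∎
  where
  open ≡-Reasoning
  basis : Subset _ → Bool
  basis = isBasisMonomial B d

AgreeOutside : SZQ n → SZQ n → Subset n → Set
AgreeOutside B′ B W = ∀ {i j} → i ∉ W → j ∉ W → i ≢ j → kill B′ i j ≡ kill B i j

nonzero-transfer : ∀ (B′ B : SZQ n) {W T w u} → AgreeOutside B′ B W → (∀ {h} → h ∉ W → kill B′ w h ≡ kill B u h) →
  w ∈ W → u ∈ W → Empty (W ∩ T) → NonzeroMonomial B (T [ u ]≔ true) → NonzeroMonomial B′ (T [ w ]≔ true)
nonzero-transfer B′ B {W} {T} {w} {u} agree sameProducts w∈W u∈W W∩T=∅ nz = nonzero
  where
  outside : ∀ {x} → x ∈ T → x ∉ W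
  outside = Empty[p∩q]∧x∈q⇒x∉p W∩T=∅
  u≢outside : ∀ {x} → x ∈ T → u ≢ x
  u≢outside x∈T = x∈p∧y∉p⇒x≢y u∈W (outside x∈T)
  inside : ∀ {x} → x ∈ T → x ∈ T [ u ]≔ true
  inside x∈T = x∈p⇒x∈p[y]≔b true (≢-sym (u≢outside x∈T)) x∈T
  edge : ∀ {h} → h ∈ T → kill B′ w h ≡ false
  edge h∈T = trans (sameProducts (outside h∈T)) (nz (x∈p[x]≔true T u) (inside h∈T) (u≢outside h∈T))
  nonzero : NonzeroMonomial B′ (T [ w ]≔ true)
  nonzero {i} {j} i∈ j∈ i≢j with i ≟ w | j ≟ w
  ... | yes refl | yes refl = contradiction refl i≢j
  ... | yes refl | no  j≢w  = edge (x∈p[y]≔b⇒x∈p true j≢w j∈)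
  ... | no  i≢w  | yes refl = trans (kill-sym B′ i w) (edge (x∈p[y]≔b⇒x∈p true i≢w i∈))
  ... | no  i≢w  | no  j≢w  = trans
    (agree (outside i∈T) (outside j∈T) i≢j) (nz (inside i∈T) (inside j∈T) i≢j)
    where
    i∈T : i ∈ T
    i∈T = x∈p[y]≔b⇒x∈p true i≢w i∈
    j∈T : j ∈ T
    j∈T = x∈p[y]≔b⇒x∈p true j≢w j∈

basisAvoiding-cong : ∀ (B′ B : SZQ n) {W} → AgreeOutside B′ B W → ∀ d → basisAvoiding B′ W d ≡ basisAvoiding B W d
basisAvoiding-cong B′ B {W} agree d = ∑ₛ-cong same
  where
  same : ∀ T → 𝟙 (avoids W T) * 𝟙 (isBasisMonomial B′ d T) ≡ 𝟙 (avoids W T) * 𝟙 (isBasisMonomial B d T)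
  same T with nonempty? (W ∩ T)
  ... | yes _     = refl
  ... | no  W∩T=∅ = cong (λ b → 1 * 𝟙 ((∣ T ∣ ≡ᵇ d) ∧ b)) (nonzeroMono-≡ {B = B′} {B} {T} {T}
    (λ nz i∈T j∈T i≢j → trans (sym (agree (outside i∈T) (outside j∈T) i≢j)) (nz i∈T j∈T i≢j))
    (λ nz i∈T j∈T i≢j → trans (agree (outside i∈T) (outside j∈T) i≢j) (nz i∈T j∈T i≢j)))
    where
    outside : ∀ {x} → x ∈ T → x ∉ W
    outside = Empty[p∩q]∧x∈q⇒x∉p W∩T=∅

basisThrough-cong : ∀ (B′ B : SZQ n) {W w u} → AgreeOutside B′ B W → (∀ {h} → h ∉ W → kill B′ w h ≡ kill B u h) →
  w ∈ W → u ∈ W → ∀ d → basisThrough B′ W d w ≡ basisThrough B W d u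
basisThrough-cong B′ B {W} {w} {u} agree sameProducts w∈W u∈W d = ∑ₛ-cong same
  where
  same : ∀ T → 𝟙 (avoids W T) * 𝟙 (isBasisMonomial B′ d (T [ w ]≔ true))
             ≡ 𝟙 (avoids W T) * 𝟙 (isBasisMonomial B d (T [ u ]≔ true))
  same T with nonempty? (W ∩ T)
  ... | yes _     = refl
  ... | no  W∩T=∅ = cong (λ b → 1 * 𝟙 b) (cong₂ _∧_ (cong (_≡ᵇ d) sizes) (nonzeroMono-≡ {B = B′} {B}
    (nonzero-transfer B B′ (λ i∉W j∉W i≢j → sym (agree i∉W j∉W i≢j)) (sym ∘ sameProducts) u∈W w∈W W∩T=∅)
    (nonzero-transfer B′ B agree sameProducts w∈W u∈W W∩T=∅)))
    where
    sizes : ∣ T [ w ]≔ true ∣ ≡ ∣ T [ u ]≔ true ∣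
    sizes = trans (x∉p⇒∣p[x]≔true∣≡suc∣p∣ T w (Empty[p∩q]∧x∈p⇒x∉q W∩T=∅ w∈W))
            (sym (x∉p⇒∣p[x]≔true∣≡suc∣p∣ T u (Empty[p∩q]∧x∈p⇒x∉q W∩T=∅ u∈W)))

prodZero-≢ : ∀ (B : SZQ n) {i j} → i ≢ j → prodZero B i j ≡ kill B i j
prodZero-≢ B {i} {j} i≢j = cong (_∨ kill B i j) (dec-false (i ≟ j) i≢j)

killed⇒ProdZero : ∀ (B : SZQ n) {i j} → kill B i j ≡ true → ProdZero B i j
killed⇒ProdZero B {i} {j} killed = trans (cong (does (i ≟ j) ∨_) killed) (∨-zeroʳ _)

Twins : SZQ n → Subset n → Set
Twins B U = ∀ {u u′ h} → u ∈ U → u′ ∈ U → h ∉ U → kill B u h ≡ kill B u′ h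

parallelClass⇒allProductsZero : ∀ (A : SZQ n) {U} → IsParallelClass A U → AllProductsZero A U
parallelClass⇒allProductsZero A (_ , class) i∈U j∈U i≢j =
  trans (sym (prodZero-≢ A i≢j)) (proj₁ (proj₁ (class _ i∈U _) j∈U))

parallelClass⇒twins : ∀ (A : SZQ n) {U} → IsParallelClass A U → Twins A U
parallelClass⇒twins A (_ , class) {u} {u′} {h} u∈U u′∈U h∉U = begin
  kill A u h      ≡⟨ prodZero-≢ A u≢h ⟨
  prodZero A u h  ≡⟨ proj₂ (proj₁ (class u u∈U u′) u′∈U) h (≢-sym u≢h) (≢-sym u′≢h) ⟩
  prodZero A u′ h ≡⟨ prodZero-≢ A u′≢h ⟩
  kill A u′ h     ∎
  where
  open ≡-Reasoning
  u≢h : u ≢ h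
  u≢h = x∈p∧y∉p⇒x≢y u∈U h∉U
  u′≢h : u′ ≢ h
  u′≢h = x∈p∧y∉p⇒x≢y u′∈U h∉U

parallelClasses-disjoint : ∀ (A : SZQ n) {U V x} → IsParallelClass A U → IsParallelClass A V → U ≢ V →
  x ∈ U → x ∉ V
parallelClasses-disjoint A (_ , classU) (_ , classV) U≢V x∈U x∈V = U≢V (⊆-antisym
  (λ y∈U → proj₂ (classV _ x∈V _) (proj₁ (classU _ x∈U _) y∈U))
  (λ y∈V → proj₂ (classU _ x∈U _) (proj₁ (classV _ x∈V _) y∈V)))

∪-allProductsZero : ∀ (B : SZQ n) {U V} → AllProductsZero B U → AllProductsZero B V →
  (∀ {u v} → u ∈ U → v ∈ V → kill B u v ≡ true) → AllProductsZero B (U ∪ V)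
∪-allProductsZero B {U} {V} zeroU zeroV cross {i} {j} i∈U∪V j∈U∪V i≢j
  with x∈p∪q⁻ U V i∈U∪V | x∈p∪q⁻ U V j∈U∪V
... | inj₁ i∈U | inj₁ j∈U = zeroU i∈U j∈U i≢j
... | inj₁ i∈U | inj₂ j∈V = cross i∈U j∈V
... | inj₂ i∈V | inj₁ j∈U = trans (kill-sym B i j) (cross j∈U i∈V)
... | inj₂ i∈V | inj₂ j∈V = zeroV i∈V j∈V i≢j

∨-absorbedˡ : ∀ {x y} → (x ≡ true → y ≡ true) → x ∨ y ≡ y
∨-absorbedˡ {true}  x⇒y = sym (x⇒y refl)
∨-absorbedˡ {false} _   = refl

module Clone (A : SZQ n) {U V : Subset n} {u₀ : Fin n} (u₀∈U : u₀ ∈ U) (U∩V=∅ : ∀ {x} → x ∈ U → x ∉ V)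
             (zeroW : AllProductsZero A (U ∪ V)) (twinsU : Twins A U) where

  W : Subset n
  W = U ∪ V

  redirect : Fin n → Fin n
  redirect i = if lookup V i then u₀ else i

  -- The first disjunct matters for pairs that redirect to the same variable, such as v ∈ V and u₀,
  -- where kill A u₀ u₀ is an arbitrary diagonal value.
  clone : SZQ n
  clone = record
    { kill     = λ a b → (lookup W a ∧ lookup W b) ∨ kill A (redirect a) (redirect b)
    ; kill-sym = λ a b → cong₂ _∨_ (∧-comm (lookup W a) (lookup W b)) (kill-sym A (redirect a) (redirect b))
    }

  redirect-∉V : ∀ {i} → i ∉ V → redirect i ≡ i
  redirect-∉V {i} i∉V = cong (if_then u₀ else i) (x∉p⇒lookup≡false i∉V)

  redirect-∈U : ∀ {i} → i ∈ W → redirect i ∈ U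
  redirect-∈U {i} i∈W with x∈p∪q⁻ U V i∈W
  ... | inj₁ i∈U = subst (_∈ U) (sym (redirect-∉V (U∩V=∅ i∈U))) i∈U
  ... | inj₂ i∈V = subst (_∈ U) (sym (cong (if_then u₀ else i) ([]=⇒lookup i∈V))) u₀∈U

  clone-kill-W : ∀ {a b} → a ∈ W → b ∈ W → kill clone a b ≡ true
  clone-kill-W {a} {b} a∈W b∈W =
    cong₂ (λ x y → (x ∧ y) ∨ kill A (redirect a) (redirect b)) ([]=⇒lookup a∈W) ([]=⇒lookup b∈W)

  clone-kill-∉V : ∀ {a b} → a ∉ V → b ∉ V → a ≢ b → kill clone a b ≡ kill A a b
  clone-kill-∉V {a} {b} a∉V b∉V a≢b = begin
    (lookup W a ∧ lookup W b) ∨ kill A (redirect a) (redirect b)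
      ≡⟨ cong₂ (λ x y → (lookup W a ∧ lookup W b) ∨ kill A x y) (redirect-∉V a∉V) (redirect-∉V b∉V) ⟩
    (lookup W a ∧ lookup W b) ∨ kill A a b
      ≡⟨ ∨-absorbedˡ (λ a,b∈W →
           zeroW (lookup⇒[]= a W (∧-conicalˡ _ _ a,b∈W)) (lookup⇒[]= b W (∧-conicalʳ _ _ a,b∈W)) a≢b) ⟩
    kill A a b ∎
    where open ≡-Reasoning

  clone-kill-outside : ∀ {w h} → w ∈ W → h ∉ W → kill clone w h ≡ kill A u₀ h
  clone-kill-outside {w} {h} w∈W h∉W = begin
    (lookup W w ∧ lookup W h) ∨ kill A (redirect w) (redirect h)
      ≡⟨ cong₂ (λ x y → (lookup W w ∧ x) ∨ kill A (redirect w) y)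
               (x∉p⇒lookup≡false h∉W) (redirect-∉V (x∉p∪q⇒x∉q h∉W)) ⟩
    (lookup W w ∧ false) ∨ kill A (redirect w) h
      ≡⟨ cong (_∨ kill A (redirect w) h) (∧-zeroʳ (lookup W w)) ⟩
    kill A (redirect w) h
      ≡⟨ twinsU (redirect-∈U w∈W) u₀∈U (x∉p∪q⇒x∉p h∉W) ⟩
    kill A u₀ h ∎
    where open ≡-Reasoning

  clone-parallel : ∀ i j → i ∈ W → j ∈ W → Parallel clone i j
  clone-parallel i j i∈W j∈W = killed⇒ProdZero clone (clone-kill-W i∈W j∈W) , sameProducts
    where
    open ≡-Reasoning
    sameProducts : ∀ h → h ≢ i → h ≢ j → prodZero clone i h ≡ prodZero clone j h
    sameProducts h h≢i h≢j with h ∈? W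
    ... | yes h∈W = trans (killed⇒ProdZero clone (clone-kill-W i∈W h∈W))
                          (sym (killed⇒ProdZero clone (clone-kill-W j∈W h∈W)))
    ... | no  h∉W = begin
      prodZero clone i h ≡⟨ prodZero-≢ clone (≢-sym h≢i) ⟩
      kill clone i h     ≡⟨ clone-kill-outside i∈W h∉W ⟩
      kill A u₀ h        ≡⟨ clone-kill-outside j∈W h∉W ⟨
      kill clone j h     ≡⟨ prodZero-≢ clone (≢-sym h≢j) ⟨
      prodZero clone j h ∎

  clone-replaces : ReplaceByClones A U V clone
  clone-replaces = (λ i j i∈W j∈W → killed⇒ProdZero clone (clone-kill-W i∈W j∈W)) , copies , unchanged
    where
    open ≡-Reasoning
    copies : ∀ v u z → v ∈ V → u ∈ U → z ∉ U → z ∉ V → prodZero clone v z ≡ prodZero A u z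
    copies v u z v∈V u∈U z∉U z∉V = begin
      prodZero clone v z ≡⟨ prodZero-≢ clone (x∈p∧y∉p⇒x≢y v∈V z∉V) ⟩
      kill clone v z     ≡⟨ clone-kill-outside (x∈p∪q⁺ (inj₂ v∈V)) z∉W ⟩
      kill A u₀ z        ≡⟨ twinsU u₀∈U u∈U z∉U ⟩
      kill A u z         ≡⟨ prodZero-≢ A (x∈p∧y∉p⇒x≢y u∈U z∉U) ⟨
      prodZero A u z     ∎
      where
      z∉W : z ∉ W
      z∉W z∈W = [ z∉U , z∉V ]′ (x∈p∪q⁻ U V z∈W)
    unchanged : ∀ i j → i ∉ V → j ∉ V → prodZero clone i j ≡ prodZero A i j
    unchanged i j i∉V j∉V with i ≟ j
    ... | yes _   = refl
    ... | no  i≢j = clone-kill-∉V i∉V j∉V i≢j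

  dimA-clone : ∀ d → dimA clone d ≡ basisAvoiding A W d + ∑∈ W (λ _ → basisThrough A W d u₀)
  dimA-clone d = begin
    dimA clone d
      ≡⟨ dimA-decomposition clone W (λ i∈W j∈W _ → clone-kill-W i∈W j∈W) d ⟩
    basisAvoiding clone W d + ∑∈ W (basisThrough clone W d)
      ≡⟨ cong₂ _+_ (basisAvoiding-cong clone A agree d)
                   (∑∈-cong W λ w∈W → basisThrough-cong clone A agree (clone-kill-outside w∈W) w∈W u₀∈W d) ⟩
    basisAvoiding A W d + ∑∈ W (λ _ → basisThrough A W d u₀) ∎
    where
    open ≡-Reasoning
    agree : AgreeOutside clone A W
    agree i∉W j∉W = clone-kill-∉V (x∉p∪q⇒x∉q i∉W) (x∉p∪q⇒x∉q j∉W)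
    u₀∈W : u₀ ∈ W
    u₀∈W = x∈p∪q⁺ (inj₁ u₀∈U)

-- W is a separate argument so that the lemma also applies with the roles of U and V swapped.
mergeClasses : ∀ (A : SZQ n) (q r : ℕ) {U V W u₀ v₀} → U ∪ V ≡ W → u₀ ∈ U → v₀ ∈ V → (∀ {x} → x ∈ U → x ∉ V) →
  AllProductsZero A W → Twins A U → Twins A V → dimA A (suc q) ≡ 0 →
  basisThrough A W r v₀ ≤ basisThrough A W r u₀ →
  ∃ λ (A′ : SZQ n) → ReplaceByClones A U V A′ × dimA A′ (suc q) ≡ 0 × dimA A′ r ≥ dimA A r
                     × (∀ i j → i ∈ W → j ∈ W → Parallel A′ i j)
mergeClasses A q r {U} {V} {u₀ = u₀} {v₀} refl u₀∈U v₀∈V U∩V=∅ zeroW twinsU twinsV dim₀ v≤u =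
  clone , clone-replaces , vanishes , dominates , clone-parallel
  where
  open Clone A u₀∈U U∩V=∅ zeroW twinsU

  u₀∈W : u₀ ∈ W
  u₀∈W = x∈p∪q⁺ (inj₁ u₀∈U)

  v₀∈W : v₀ ∈ W
  v₀∈W = x∈p∪q⁺ (inj₂ v₀∈V)

  twinsThrough : ∀ {x y} → (∀ {h} → h ∉ W → kill A x h ≡ kill A y h) → x ∈ W → y ∈ W →
    basisThrough A W r x ≡ basisThrough A W r y
  twinsThrough sameProducts x∈W y∈W = basisThrough-cong A A (λ _ _ _ → refl) sameProducts x∈W y∈W r

  through≤ : ∀ {w} → w ∈ W → basisThrough A W r w ≤ basisThrough A W r u₀
  through≤ w∈W with x∈p∪q⁻ U V w∈W
  ... | inj₁ w∈U = ≤-reflexive (twinsThrough (twinsU w∈U u₀∈U ∘ x∉p∪q⇒x∉p) w∈W u₀∈W)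
  ... | inj₂ w∈V = ≤-trans (≤-reflexive (twinsThrough (twinsV w∈V v₀∈V ∘ x∉p∪q⇒x∉q) w∈W v₀∈W)) v≤u

  dominates : dimA clone r ≥ dimA A r
  dominates = begin
    dimA A r
      ≡⟨ dimA-decomposition A W zeroW r ⟩
    basisAvoiding A W r + ∑∈ W (basisThrough A W r)
      ≤⟨ +-monoʳ-≤ (basisAvoiding A W r) (∑∈-mono-≤ W through≤) ⟩
    basisAvoiding A W r + ∑∈ W (λ _ → basisThrough A W r u₀)
      ≡⟨ dimA-clone r ⟨
    dimA clone r ∎
    where open ≤-Reasoning

  decomposition₀ : basisAvoiding A W (suc q) + ∑∈ W (basisThrough A W (suc q)) ≡ 0
  decomposition₀ = trans (sym (dimA-decomposition A W zeroW (suc q))) dim₀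

  through₀ : basisThrough A W (suc q) u₀ ≡ 0
  through₀ = n≤0⇒n≡0 (≤-trans (f≤∑∈f (basisThrough A W (suc q)) u₀∈W)
                              (≤-reflexive (m+n≡0⇒n≡0 _ decomposition₀)))

  vanishes : dimA clone (suc q) ≡ 0
  vanishes = begin
    dimA clone (suc q)
      ≡⟨ dimA-clone (suc q) ⟩
    basisAvoiding A W (suc q) + ∑∈ W (λ _ → basisThrough A W (suc q) u₀)
      ≡⟨ cong₂ _+_ (m+n≡0⇒m≡0 _ decomposition₀) (∑∈-cong W λ _ → through₀) ⟩
    ∑∈ W (λ _ → 0)
      ≡⟨ ∑∈-zero W ⟩
    0 ∎
    where open ≡-Reasoning

lemma4p1 : ∀ {n} (A : SZQ n) (q r : ℕ) (U V : Subset n) →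
    dimA A (suc q) ≡ 0 →
    IsParallelClass A U → IsParallelClass A V → U ≢ V →
    (∀ u v → u ∈ U → v ∈ V → ProdZero A u v) →
    ∃ λ (A' : SZQ n) →
      (ReplaceByClones A V U A' ⊎ ReplaceByClones A U V A')
      × dimA A' (suc q) ≡ 0
      × dimA A' r ≥ dimA A r
      × (∀ i j → i ∈ (U ∪ V) → j ∈ (U ∪ V) → Parallel A' i j)
lemma4p1 A q r U V dim₀ classU@((u₀ , u₀∈U) , _) classV@((v₀ , v₀∈V) , _) U≢V UV-zero =
  [ (λ v≤u → map₂ (map₁ inj₂)
      (mergeClasses A q r refl u₀∈U v₀∈V U∩V=∅ zeroW twinsU twinsV dim₀ v≤u))
  , (λ u≤v → map₂ (map₁ inj₁)
      (mergeClasses A q r (∪-comm V U) v₀∈V u₀∈U (flip U∩V=∅) zeroW twinsV twinsU dim₀ u≤v))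
  ]′ (≤-total (basisThrough A (U ∪ V) r v₀) (basisThrough A (U ∪ V) r u₀))
  where
  U∩V=∅ : ∀ {x} → x ∈ U → x ∉ V
  U∩V=∅ = parallelClasses-disjoint A classU classV U≢V
  twinsU : Twins A U
  twinsU = parallelClass⇒twins A classU
  twinsV : Twins A V
  twinsV = parallelClass⇒twins A classV
  zeroW : AllProductsZero A (U ∪ V)
  zeroW = ∪-allProductsZero A (parallelClass⇒allProductsZero A classU) (parallelClass⇒allProductsZero A classV)
    λ u∈U v∈V → trans (sym (prodZero-≢ A (≢-sym (x∈p∧y∉p⇒x≢y v∈V (U∩V=∅ u∈U))))) (UV-zero _ _ u∈U v∈V)
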